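{- Let $G$ be a graph, let $C=v_1v_2\cdots v_mv_1$ be an induced cycle of length at least $4$ in $G$, and let $w_1,w_2,w_3,w_4\in V(G)\setminus V(C)$ be such that (1) $v_2w_1w_2w_3w_4$ is an induced path, (2) $v_2w_1$ is the only edge between $\{v_1,v_2,v_3,v_4\}$ and $\{w_1,w_2,w_3,w_4\}$, and (3) each vertex of $C$ has at most one neighbor in $\{w_1,w_2,w_3,w_4\}$. Then $G[V(C)\cup\{w_1,w_2,w_3,w_4\}]$ contains an induced subdivision of the $2$-pan.
   Context: All graphs are finite and simple. The $2$-pan is obtained from the disjoint union of a triangle and a path with $2$ edges by identifying one endpoint of the path with a vertex of the triangle. An induced subdivision of $H$ in $G$ is an induced subgraph of $G$ isomorphic to a graph obtained from $H$ by repeatedly replacing an edge by a path of length two through a new vertex. -}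

module Defs where

open import Data.Nat using (ℕ; zero; suc; _+_; NonZero)
open import Data.Nat.DivMod using (_%_)
open import Data.Fin using (Fin; zero; suc; toℕ; inject₁; fromℕ)
open import Data.Product using (_×_; _,_; ∃; ∃-syntax; Σ-syntax)
open import Data.Sum using (_⊎_)
open import Data.List using (List; []; _∷_; map)
open import Data.List.Membership.Propositional using (_∈_)
open import Data.List.Relation.Unary.Any using (_─_)
open import Relation.Binary.PropositionalEquality using (_≡_)
open import Relation.Nullary using (¬_; Dec)
open import Function.Definitions using (Injective)
open import Function.Bundles using (_⇔_)

record Graph (n : ℕ) : Set₁ where
  field
    Adj    : Fin n → Fin n → Set
    adj?   : ∀ x y → Dec (Adj x y)
    sym    : ∀ {x y} → Adj x y → Adj y x
    irrefl : ∀ {x} → ¬ Adj x x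
open Graph public

CycAdj : (m : ℕ) → .{{ NonZero m }} → Fin m → Fin m → Set
CycAdj m i j = (toℕ j ≡ suc (toℕ i) % m) ⊎ (toℕ i ≡ suc (toℕ j) % m)

record IsInducedCycle {n : ℕ} (G : Graph n) (m : ℕ) .{{ _ : NonZero m }}
                      (v : Fin m → Fin n) : Set where
  field
    injective : Injective _≡_ _≡_ v
    adjacency : ∀ i j → Adj G (v i) (v j) ⇔ CycAdj m i j

PathAdj : {m : ℕ} → Fin m → Fin m → Set
PathAdj i j = (toℕ j ≡ suc (toℕ i)) ⊎ (toℕ i ≡ suc (toℕ j))

record IsInducedPath {n : ℕ} (G : Graph n) (m : ℕ) (p : Fin m → Fin n) : Set where
  field
    injective : Injective _≡_ _≡_ p
    adjacency : ∀ i j → Adj G (p i) (p j) ⇔ PathAdj i j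

EdgeList : ℕ → Set
EdgeList k = List (Fin k × Fin k)

EAdj : {k : ℕ} → EdgeList k → Fin k → Fin k → Set
EAdj E x y = ((x , y) ∈ E) ⊎ ((y , x) ∈ E)

liftEdge : {k : ℕ} → Fin k × Fin k → Fin (suc k) × Fin (suc k)
liftEdge (a , b) = inject₁ a , inject₁ b

-- Subdivide k E k' E' : the graph (Fin k' , E') is obtained from
-- (Fin k , E) by repeatedly replacing an edge ab by a path a x b
-- through a new vertex x.
data Subdivide (k : ℕ) (E : EdgeList k) : (k' : ℕ) → EdgeList k' → Set where
  done : Subdivide k E k E
  step : ∀ {k' E' a b} → Subdivide k E k' E' → (e : (a , b) ∈ E') →
         Subdivide k E (suc k')
           ((inject₁ a , fromℕ k') ∷ (fromℕ k' , inject₁ b) ∷ map liftEdge (E' ─ e))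

-- The 2-pan: triangle 0 1 2, with path 0 - 3 - 4 attached at 0.
panEdges : EdgeList 5
panEdges = (zero , suc zero) ∷ (suc zero , suc (suc zero)) ∷ (suc (suc zero) , zero)
         ∷ (zero , suc (suc (suc zero))) ∷ (suc (suc (suc zero)) , suc (suc (suc (suc zero)))) ∷ []

ContainsInduced : {n : ℕ} → Graph n → (Fin n → Set) → (k : ℕ) → EdgeList k → Set
ContainsInduced {n} G S k E =
  Σ[ f ∈ (Fin k → Fin n) ] (Injective _≡_ _≡_ f × (∀ x → S (f x))
     × (∀ x y → Adj G (f x) (f y) ⇔ EAdj E x y))

HasInducedSubdivOf2Pan : {n : ℕ} → Graph n → (Fin n → Set) → Set
HasInducedSubdivOf2Pan G S =
  ∃[ k' ] Σ[ E' ∈ EdgeList k' ] (Subdivide 5 panEdges k' E' × ContainsInduced G S k' E')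

-- An induced path q₀ … q_(4+s) together with a vertex x off it whose only
-- neighbours on it are q₂ and q_(4+s) induces a subdivided 2-pan: the cycle
-- x q₂ … q_(4+s) x with the pendant path q₂ q₁ q₀.  Such a path and apex are
-- found from the last vertex v_b (b ≥ 5) of C with a neighbour in {w₁, …, w₄},
-- say w_t (unique by (3)).
--   * b ≥ 6:            x = v₁ and q = v₄ v₃ v₂ w₁ … w_t v_b … v_m.
--   * b = 5 and t ≤ 2:  x = v₅ and q = w_(t+2) … w₁ v₂ v₃ v₄.
--   * otherwise w₁ and w₂ have no neighbour on C but v₂ (by (2) on v₁ … v₄),
--     so x = v₁ and q = w₂ w₁ v₂ v₃ … v_m.

module Submission where

open import Defs
open import Data.Nat using (ℕ; _+_)
open import Data.Fin using (Fin; zero; suc; _↑ˡ_)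
open import Data.Product using (_×_; _,_; ∃-syntax)
open import Data.Sum using (_⊎_)
open import Data.Vec.Functional using (_∷_)
open import Relation.Binary.PropositionalEquality using (_≡_; _≢_)

open import Data.Nat using (zero; suc; _∸_; _≤_; _<_; z≤n; s≤s; NonZero; _%_)
open import Data.Nat.Properties
open import Data.Nat.DivMod using (_mod_; m<n⇒m%n≡m; n%n≡0)
open import Data.Fin using (toℕ; fromℕ; fromℕ<; inject₁; #_)
open import Data.Fin.Properties using (toℕ-injective; toℕ-inject₁; toℕ-fromℕ; toℕ-fromℕ<; toℕ-↑ˡ; toℕ<n; all?; any?)
  renaming (_≟_ to _≟ᶠ_)
open import Data.Product using (Σ-syntax)
import Data.Product
open import Data.Product.Properties using (≡-dec)
open import Data.Sum using (inj₁; inj₂; [_,_])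
import Data.Sum
open import Data.Empty using (⊥-elim)
import Data.List as List
open import Data.List.Relation.Unary.Any using (here; there)
open import Data.List.Membership.Propositional using (_∈_)
open import Data.List.Membership.Propositional.Properties using (∈-map⁻; ∈-map⁺)
open import Data.List.Membership.DecPropositional using () renaming (_∈?_ to ∈?)
open import Function using (_∘_; const)
open import Function.Bundles using (_⇔_; mk⇔; Equivalence)
import Function.Properties.Equivalence as ⇔
open import Relation.Nullary using (¬_; Dec; yes; no)
open import Relation.Nullary.Decidable using (toWitness; _⊎-dec_; _→-dec_; _×-dec_)
open import Relation.Unary using (Pred; Decidable)
open import Relation.Binary.PropositionalEquality using (refl; trans; cong; subst; subst₂; module ≡-Reasoning)
  renaming (sym to ≡-sym)

private variable
  A : Set
  a b i j j′ M N s : ℕ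

Consecutive : ℕ → ℕ → Set
Consecutive i j = (j ≡ suc i) ⊎ (i ≡ suc j)

consecutive? : ∀ i j → Dec (Consecutive i j)
consecutive? i j = (j ≟ suc i) ⊎-dec (i ≟ suc j)

Consecutive-sym : Consecutive i j → Consecutive j i
Consecutive-sym (inj₁ e) = inj₂ e
Consecutive-sym (inj₂ e) = inj₁ e

Consecutive-irrefl : ¬ Consecutive i i
Consecutive-irrefl (inj₁ e) = <-irrefl e (n<1+n _)
Consecutive-irrefl (inj₂ e) = <-irrefl e (n<1+n _)

far-¬Consecutive : suc i < j → ¬ Consecutive i j
far-¬Consecutive i+1<j (inj₁ refl) = <-irrefl refl i+1<j
far-¬Consecutive {j = j} i+1<j (inj₂ refl) = <⇒≱ i+1<j (≤-trans (n≤1+n j) (n≤1+n (suc j)))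

+-Consecutive : ∀ a → Consecutive i j → Consecutive (a + i) (a + j)
+-Consecutive {i} {j} a (inj₁ e) = inj₁ (trans (cong (a +_) e) (+-suc a i))
+-Consecutive {i} {j} a (inj₂ e) = inj₂ (trans (cong (a +_) e) (+-suc a j))

+-Consecutive⁻ : ∀ a → Consecutive (a + i) (a + j) → Consecutive i j
+-Consecutive⁻ {i} {j} a (inj₁ e) = inj₁ (+-cancelˡ-≡ a _ _ (trans e (≡-sym (+-suc a i))))
+-Consecutive⁻ {i} {j} a (inj₂ e) = inj₂ (+-cancelˡ-≡ a _ _ (trans e (≡-sym (+-suc a j))))

∸-Consecutive⁻ : i ≤ M → j ≤ M → Consecutive (M ∸ i) (M ∸ j) → Consecutive i j
∸-Consecutive⁻ i≤M j≤M (inj₁ e) = inj₂ (∸-suc⁻ i≤M j≤M e)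
  where
  ∸-suc⁻ : i ≤ M → j ≤ M → M ∸ j ≡ suc (M ∸ i) → i ≡ suc j
  ∸-suc⁻ {i} {M} {j} i≤M j≤M e = ≡-sym (+-cancelˡ-≡ (M ∸ i) _ _ (begin
    M ∸ i + suc j    ≡⟨ +-suc (M ∸ i) j ⟩
    suc (M ∸ i) + j  ≡⟨ cong (_+ j) e ⟨
    M ∸ j + j        ≡⟨ m∸n+n≡m j≤M ⟩
    M                ≡⟨ m∸n+n≡m i≤M ⟨
    M ∸ i + i        ∎))
    where open ≡-Reasoning
∸-Consecutive⁻ i≤M j≤M (inj₂ e) = Consecutive-sym (∸-Consecutive⁻ j≤M i≤M (inj₁ e))

join : ℕ → (ℕ → A) → (ℕ → A) → ℕ → A
join zero    p r i       = r i
join (suc N) p r zero    = p zero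
join (suc N) p r (suc i) = join N (p ∘ suc) r i

join-< : ∀ N (p r : ℕ → A) → i < N → join N p r i ≡ p i
join-< {i = zero}  (suc N) p r _         = refl
join-< {i = suc i} (suc N) p r (s≤s i<N) = join-< N (p ∘ suc) r i<N

join-+ : ∀ N (p r : ℕ → A) j → join N p r (N + j) ≡ r j
join-+ zero    p r j = refl
join-+ (suc N) p r j = join-+ N (p ∘ suc) r j

join-at : ∀ N (p r : ℕ → A) → join N p r N ≡ r 0
join-at N p r = trans (cong (join N p r) (≡-sym (+-identityʳ N))) (join-+ N p r 0)

join-all : (P : A → Set) → ∀ N (p r : ℕ → A) → (∀ i → P (p i)) → (∀ j → P (r j)) →
           ∀ i → P (join N p r i)
join-all P zero    p r Pp Pr i       = Pr i
join-all P (suc N) p r Pp Pr zero    = Pp zero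
join-all P (suc N) p r Pp Pr (suc i) = join-all P N (p ∘ suc) r (Pp ∘ suc) Pr i

join-elim : (P : A → Set) → ∀ N {M} (p r : ℕ → A) → i < N + M →
            (i < N → P (p i)) → (∀ j → j < M → i ≡ N + j → P (r j)) → P (join N p r i)
join-elim P zero    p r i<M f g = g _ i<M refl
join-elim {i = zero}  P (suc N) p r _ f g = f (s≤s z≤n)
join-elim {i = suc i} P (suc N) p r (s≤s i<N+M) f g =
  join-elim P N (p ∘ suc) r i<N+M (f ∘ s≤s) (λ j j<M e → g j j<M (cong suc e))

module _ {n : ℕ} (G : Graph n) where

  record InducedPath (q : ℕ → Fin n) (N : ℕ) : Set where
    field
      injective : ∀ {i j} → i < N → j < N → q i ≡ q j → i ≡ j
      adjacent⇒consecutive : ∀ {i j} → i < N → j < N → Adj G (q i) (q j) → Consecutive i j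
      adjacent-suc : ∀ {i} → suc i < N → Adj G (q i) (q (suc i))
  open InducedPath

  take⁺ : ∀ {q} → M ≤ N → InducedPath q N → InducedPath q M
  take⁺ M≤N P = record
    { injective            = λ i<M j<M → injective P (<-≤-trans i<M M≤N) (<-≤-trans j<M M≤N)
    ; adjacent⇒consecutive = λ i<M j<M → adjacent⇒consecutive P (<-≤-trans i<M M≤N) (<-≤-trans j<M M≤N)
    ; adjacent-suc         = λ i<M → adjacent-suc P (<-≤-trans i<M M≤N)
    }

  drop⁺ : ∀ {q} a → InducedPath q (a + N) → InducedPath (q ∘ (a +_)) N
  drop⁺ {N = N} {q = q} a P = record
    { injective            = λ i<N j<N e →
                               +-cancelˡ-≡ a _ _ (injective P (+-monoʳ-< a i<N) (+-monoʳ-< a j<N) e)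
    ; adjacent⇒consecutive = λ i<N j<N x →
                               +-Consecutive⁻ a (adjacent⇒consecutive P (+-monoʳ-< a i<N) (+-monoʳ-< a j<N) x)
    ; adjacent-suc         = λ {i} i<N → subst (Adj G (q (a + i)) ∘ q) (≡-sym (+-suc a i))
                               (adjacent-suc P (subst (_< a + N) (+-suc a i) (+-monoʳ-< a i<N)))
    }

  reverse⁺ : ∀ {q} → InducedPath q (suc M) → InducedPath (q ∘ (M ∸_)) (suc M)
  reverse⁺ {M = M} {q = q} P = record
    { injective            = λ {i} {j} i<M j<M e →
                               ∸-cancelˡ-≡ (≤-pred i<M) (≤-pred j<M) (injective P (∸<1+ i) (∸<1+ j) e)
    ; adjacent⇒consecutive = λ {i} {j} i<M j<M x →
                               ∸-Consecutive⁻ (≤-pred i<M) (≤-pred j<M)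
                                 (adjacent⇒consecutive P (∸<1+ i) (∸<1+ j) x)
    ; adjacent-suc         = λ {i} i<M → Graph.sym G (subst (Adj G (q (M ∸ suc i)) ∘ q) (∸-suc i<M)
                               (adjacent-suc P (subst (_< suc M) (≡-sym (∸-suc i<M)) (∸<1+ i))))
    }
    where
    ∸<1+ : ∀ i → M ∸ i < suc M
    ∸<1+ i = s≤s (m∸n≤m M i)
    ∸-suc : suc i < suc M → suc (M ∸ suc i) ≡ M ∸ i
    ∸-suc i<M = ≡-sym (+-∸-assoc 1 (≤-pred i<M))

  join-adjacent-suc : ∀ {p r : ℕ → Fin n} M → (∀ {i} → suc i < suc M → Adj G (p i) (p (suc i))) →
                      (∀ {j} → suc j < N → Adj G (r j) (r (suc j))) → Adj G (p M) (r 0) →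
                      suc i < suc M + N → Adj G (join (suc M) p r i) (join (suc M) p r (suc i))
  join-adjacent-suc {i = zero}  zero     p~ r~ p~r _         = p~r
  join-adjacent-suc {i = suc i} zero     p~ r~ p~r (s≤s i<N) = r~ i<N
  join-adjacent-suc {i = zero}  (suc M)  p~ r~ p~r _         = p~ (s≤s (s≤s z≤n))
  join-adjacent-suc {i = suc i} (suc M)  p~ r~ p~r (s≤s i<)  =
    join-adjacent-suc M (p~ ∘ s≤s) r~ p~r i<

  join⁺ : ∀ {p r} → InducedPath p (suc M) → InducedPath r N →
          (∀ {i j} → i < suc M → j < N → p i ≢ r j) →
          (∀ {i j} → i < suc M → j < N → Adj G (p i) (r j) → p i ≡ p M × r j ≡ r 0) →
          Adj G (p M) (r 0) →
          InducedPath (join (suc M) p r) (suc M + N)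
  join⁺ {M = M} {N = N} {p = p} {r = r} P R p≢r p~r p~r₀ = record
    { injective            = inj
    ; adjacent⇒consecutive = adj
    ; adjacent-suc         = join-adjacent-suc M (adjacent-suc P) (adjacent-suc R) p~r₀
    }
    where
    c = join (suc M) p r

    inj : ∀ {i j} → i < suc M + N → j < suc M + N → c i ≡ c j → i ≡ j
    inj {i} {j} i< j< = join-elim (λ x → x ≡ c j → i ≡ j) (suc M) p r i<
      (λ i<M → join-elim (λ y → p i ≡ y → i ≡ j) (suc M) p r j<
        (λ j<M → injective P i<M j<M)
        (λ j′ j′<N _ e → ⊥-elim (p≢r i<M j′<N e)))
      (λ i′ i′<N i≡ → join-elim (λ y → r i′ ≡ y → i ≡ j) (suc M) p r j<
        (λ j<M e → ⊥-elim (p≢r j<M i′<N (≡-sym e)))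
        (λ j′ j′<N j≡ e → trans i≡ (trans (cong (suc M +_) (injective R i′<N j′<N e)) (≡-sym j≡))))

    adj : ∀ {i j} → i < suc M + N → j < suc M + N → Adj G (c i) (c j) → Consecutive i j
    adj {i} {j} i< j< = join-elim (λ x → Adj G x (c j) → Consecutive i j) (suc M) p r i<
      (λ i<M → join-elim (λ y → Adj G (p i) y → Consecutive i j) (suc M) p r j<
        (λ j<M → adjacent⇒consecutive P i<M j<M)
        (λ j′ j′<N j≡ x → inj₁ (junction i<M j′<N j≡ x)))
      (λ i′ i′<N i≡ → join-elim (λ y → Adj G (r i′) y → Consecutive i j) (suc M) p r j<
        (λ j<M x → inj₂ (junction j<M i′<N i≡ (Graph.sym G x)))
        (λ j′ j′<N j≡ x → subst₂ Consecutive (≡-sym i≡) (≡-sym j≡)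
                             (+-Consecutive (suc M) (adjacent⇒consecutive R i′<N j′<N x))))
      where
      junction : ∀ {i j j′} → i < suc M → j′ < N → j ≡ suc M + j′ →
                 Adj G (p i) (r j′) → j ≡ suc i
      junction {i} {j} {j′} i<M j′<N j≡ x with p~r i<M j′<N x
      ... | pi≡pM , rj′≡r0 = begin
        j            ≡⟨ j≡ ⟩
        suc M + j′   ≡⟨ cong (suc M +_) (injective R j′<N (<-≤-trans (s≤s z≤n) j′<N) rj′≡r0) ⟩
        suc M + 0    ≡⟨ +-identityʳ (suc M) ⟩
        suc M        ≡⟨ cong suc (injective P i<M ≤-refl pi≡pM) ⟨
        suc i        ∎
        where open ≡-Reasoning

  consecutive⇒adjacent : ∀ {q} → InducedPath q N → i < N → j < N → Consecutive i j → Adj G (q i) (q j)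
  consecutive⇒adjacent P i<N j<N (inj₁ refl) = adjacent-suc P j<N
  consecutive⇒adjacent P i<N j<N (inj₂ refl) = Graph.sym G (adjacent-suc P i<N)


data FromℕOrInject₁ : Fin (suc N) → Set where
  isFromℕ   : FromℕOrInject₁ (fromℕ N)
  isInject₁ : (x : Fin N) → FromℕOrInject₁ (inject₁ x)

fromℕOrInject₁ : (x : Fin (suc N)) → FromℕOrInject₁ x
fromℕOrInject₁ {zero}  zero    = isFromℕ
fromℕOrInject₁ {suc N} zero    = isInject₁ zero
fromℕOrInject₁ {suc N} (suc x) with fromℕOrInject₁ x
... | isFromℕ     = isFromℕ
... | isInject₁ y = isInject₁ (suc y)

-- Pan labels 4 3 0 1 2 sit at positions 0 1 2 3 4 of the path; later labels are fixed.
position : ℕ → ℕ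
position 0 = 2
position 1 = 3
position 2 = 4
position 3 = 1
position 4 = 0
position (suc (suc (suc (suc (suc i))))) = 5 + i

label : ℕ → ℕ
label 0 = 4
label 1 = 3
label 2 = 0
label 3 = 1
label 4 = 2
label (suc (suc (suc (suc (suc i))))) = 5 + i

label-position : ∀ i → label (position i) ≡ i
label-position 0 = refl
label-position 1 = refl
label-position 2 = refl
label-position 3 = refl
label-position 4 = refl
label-position (suc (suc (suc (suc (suc i))))) = refl

position-injective : position i ≡ position j → i ≡ j
position-injective {i} {j} e = trans (≡-sym (label-position i)) (trans (cong label e) (label-position j))

position-< : ∀ i → i < 5 + N → position i < 5 + N
position-< 0 _ = s≤s (s≤s (s≤s z≤n))
position-< 1 _ = s≤s (s≤s (s≤s (s≤s z≤n)))
position-< 2 _ = s≤s (s≤s (s≤s (s≤s (s≤s z≤n))))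
position-< 3 _ = s≤s (s≤s z≤n)
position-< 4 _ = s≤s z≤n
position-< (suc (suc (suc (suc (suc i))))) i< = i<

pos : Fin N → ℕ
pos = position ∘ toℕ

pos-inject₁ : (x : Fin N) → pos (inject₁ x) ≡ pos x
pos-inject₁ x = cong position (toℕ-inject₁ x)

pos-fromℕ : ∀ N → pos (fromℕ (5 + N)) ≡ 5 + N
pos-fromℕ N = cong (5 +_) (toℕ-fromℕ N)

pos-injective : {x y : Fin N} → pos x ≡ pos y → x ≡ y
pos-injective = toℕ-injective ∘ position-injective

pos-< : (x : Fin (5 + N)) → pos x < 5 + N
pos-< x = position-< (toℕ x) (toℕ<n x)

apex : ∀ s → Fin (6 + s)
apex s = fromℕ (5 + s)

newestEdge : ∀ s → Fin (6 + s) × Fin (6 + s)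
newestEdge zero    = inject₁ (# 2) , apex 0
newestEdge (suc s) = inject₁ (apex s) , apex (suc s)

olderEdges : ∀ s → EdgeList (6 + s)
olderEdges zero    =
  List.map liftEdge ((# 0 , # 1) List.∷ (# 1 , # 2) List.∷ (# 0 , # 3) List.∷ (# 3 , # 4) List.∷ List.[])
olderEdges (suc s) = List.map liftEdge (newestEdge s List.∷ olderEdges s)

pathEdges : ∀ s → EdgeList (6 + s)
pathEdges s = newestEdge s List.∷ olderEdges s

-- The pan with its cycle 0 1 2 0 lengthened to 0 1 2 5 6 … (5+s) 0.
subdividedPan : ∀ s → EdgeList (6 + s)
subdividedPan s = newestEdge s List.∷ (apex s , zero) List.∷ olderEdges s

subdividedPan-subdivides : ∀ s → Subdivide 5 panEdges (6 + s) (subdividedPan s)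
subdividedPan-subdivides zero    = step done (there (there (here refl)))
subdividedPan-subdivides (suc s) = step (subdividedPan-subdivides s) (there (here refl))

Chord : ℕ → ℕ → ℕ → Set
Chord s i j = (i ≡ 5 + s × j ≡ 2) ⊎ (j ≡ 5 + s × i ≡ 2)

PanStep : ℕ → ℕ → ℕ → Set
PanStep s i j = Consecutive i j ⊎ Chord s i j

PanStep-sym : PanStep s i j → PanStep s j i
PanStep-sym (inj₁ c)        = inj₁ (Consecutive-sym c)
PanStep-sym (inj₂ (inj₁ e)) = inj₂ (inj₂ e)
PanStep-sym (inj₂ (inj₂ e)) = inj₂ (inj₁ e)

EAdj-sym : ∀ {k} {E : EdgeList k} {x y} → EAdj E x y → EAdj E y x
EAdj-sym (inj₁ e) = inj₂ e
EAdj-sym (inj₂ e) = inj₁ e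

pathEdge⇒consecutive : ∀ s {x y} → (x , y) ∈ pathEdges s → Consecutive (pos x) (pos y)
pathEdge⇒consecutive zero (here refl)                                  = inj₁ refl
pathEdge⇒consecutive zero (there (here refl))                          = inj₁ refl
pathEdge⇒consecutive zero (there (there (here refl)))                  = inj₁ refl
pathEdge⇒consecutive zero (there (there (there (here refl))))          = inj₂ refl
pathEdge⇒consecutive zero (there (there (there (there (here refl))))) = inj₂ refl
pathEdge⇒consecutive (suc s) (here refl) =
  subst₂ Consecutive (≡-sym (trans (pos-inject₁ (apex s)) (pos-fromℕ s))) (≡-sym (pos-fromℕ (suc s)))
    (inj₁ refl)
pathEdge⇒consecutive (suc s) (there xy∈) with ∈-map⁻ liftEdge xy∈
... | (x , y) , xy∈′ , refl =
  subst₂ Consecutive (≡-sym (pos-inject₁ x)) (≡-sym (pos-inject₁ y)) (pathEdge⇒consecutive s xy∈′)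

consecutive⇒pathEdge₀ : ∀ (x y : Fin 6) → Consecutive (pos x) (pos y) → EAdj (pathEdges 0) x y
consecutive⇒pathEdge₀ = toWitness {a? = all? λ x → all? λ y →
  consecutive? (pos x) (pos y) →-dec (edge? (x , y) ⊎-dec edge? (y , x))} _
  where edge? = λ e → ∈? (≡-dec _≟ᶠ_ _≟ᶠ_) e (pathEdges 0)

-- The newest vertex apex (suc s) has position 6 + s, above every older vertex.
consecutive-newest : ∀ s (y : Fin (6 + s)) → Consecutive (pos (apex (suc s))) (pos (inject₁ y)) →
                     EAdj (pathEdges (suc s)) (apex (suc s)) (inject₁ y)
consecutive-newest s y c rewrite pos-fromℕ (suc s) | pos-inject₁ y with c
... | inj₁ e = ⊥-elim (<-irrefl e (<-trans (pos-< y) (n<1+n _)))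
... | inj₂ e
  rewrite pos-injective {x = y} {y = apex s} (trans (≡-sym (suc-injective e)) (≡-sym (pos-fromℕ s)))
  = inj₂ (here refl)

consecutive⇒pathEdge : ∀ s (x y : Fin (6 + s)) → Consecutive (pos x) (pos y) → EAdj (pathEdges s) x y
consecutive⇒pathEdge zero x y = consecutive⇒pathEdge₀ x y
consecutive⇒pathEdge (suc s) x y c with fromℕOrInject₁ x | fromℕOrInject₁ y
... | isFromℕ     | isFromℕ     = ⊥-elim (Consecutive-irrefl c)
... | isFromℕ     | isInject₁ y = consecutive-newest s y c
... | isInject₁ x | isFromℕ     = EAdj-sym (consecutive-newest s x (Consecutive-sym c))
... | isInject₁ x | isInject₁ y
  with consecutive⇒pathEdge s x y (subst₂ Consecutive (pos-inject₁ x) (pos-inject₁ y) c)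
...   | inj₁ xy∈ = inj₁ (there (∈-map⁺ liftEdge xy∈))
...   | inj₂ yx∈ = inj₂ (there (∈-map⁺ liftEdge yx∈))

edge⇒pathEdge⊎chord : ∀ s {x y} → (x , y) ∈ subdividedPan s →
                      (x , y) ∈ pathEdges s ⊎ (x , y) ≡ (apex s , zero)
edge⇒pathEdge⊎chord s (here e)          = inj₁ (here e)
edge⇒pathEdge⊎chord s (there (here e))  = inj₂ e
edge⇒pathEdge⊎chord s (there (there e)) = inj₁ (there e)

pathEdge⇒edge : ∀ s {x y} → (x , y) ∈ pathEdges s → (x , y) ∈ subdividedPan s
pathEdge⇒edge s (here e)  = here e
pathEdge⇒edge s (there e) = there (there e)

subdividedPan-adjacency : ∀ s (x y : Fin (6 + s)) → EAdj (subdividedPan s) x y ⇔ PanStep s (pos x) (pos y)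
subdividedPan-adjacency s x y = mk⇔ to from
  where
  oriented : ∀ {x y} → (x , y) ∈ subdividedPan s → PanStep s (pos x) (pos y)
  oriented xy∈ with edge⇒pathEdge⊎chord s xy∈
  ... | inj₁ xy∈′ = inj₁ (pathEdge⇒consecutive s xy∈′)
  ... | inj₂ refl = inj₂ (inj₁ (pos-fromℕ s , refl))

  to : EAdj (subdividedPan s) x y → PanStep s (pos x) (pos y)
  to (inj₁ xy∈) = oriented xy∈
  to (inj₂ yx∈) = PanStep-sym (oriented yx∈)

  chord : ∀ {x y : Fin (6 + s)} → pos x ≡ 5 + s → pos y ≡ 2 → (x , y) ∈ subdividedPan s
  chord {x} {y} x≡ y≡ rewrite pos-injective {x = x} {y = apex s} (trans x≡ (≡-sym (pos-fromℕ s)))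
                            | pos-injective {x = y} {y = zero} y≡ = there (here refl)

  from : PanStep s (pos x) (pos y) → EAdj (subdividedPan s) x y
  from (inj₁ c) with consecutive⇒pathEdge s x y c
  ... | inj₁ xy∈ = inj₁ (pathEdge⇒edge s xy∈)
  ... | inj₂ yx∈ = inj₂ (pathEdge⇒edge s yx∈)
  from (inj₂ (inj₁ (x≡ , y≡))) = inj₁ (chord x≡ y≡)
  from (inj₂ (inj₂ (y≡ , x≡))) = inj₂ (chord y≡ x≡)

module _ {n : ℕ} (G : Graph n) where

  record PanModel (q : ℕ → Fin n) (s : ℕ) : Set where
    field
      injective : i < 6 + s → j < 6 + s → q i ≡ q j → i ≡ j
      adjacency : i < 6 + s → j < 6 + s → Adj G (q i) (q j) ⇔ PanStep s i j

  panModel⇒subdivision : ∀ {S : Fin n → Set} {q s} → PanModel q s → (∀ i → S (q i)) →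
                         HasInducedSubdivOf2Pan G S
  panModel⇒subdivision {q = q} {s} M S∘q =
    6 + s , subdividedPan s , subdividedPan-subdivides s ,
    q ∘ pos , (λ {x} {y} → pos-injective ∘ PanModel.injective M (pos-< x) (pos-< y)) , S∘q ∘ pos ,
    λ x y → ⇔.trans (PanModel.adjacency M (pos-< x) (pos-< y)) (⇔.sym (subdividedPan-adjacency s x y))

  apexedPath⇒PanModel : ∀ {q x} → InducedPath G q (5 + s) →
    (∀ {i} → i < 5 + s → x ≢ q i) →
    (∀ {i} → i < 5 + s → Adj G x (q i) → q i ≡ q 2 ⊎ q i ≡ q (4 + s)) →
    Adj G x (q 2) → Adj G x (q (4 + s)) →
    PanModel (join (5 + s) q (const x)) s
  apexedPath⇒PanModel {s} {q} {x} P x∉q x~q⇒ x~q₂ x~qₗ = record { injective = inj ; adjacency = adj }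
    where
    q′ = join (5 + s) q (const x)
    open InducedPath P

    2<5+s : 2 < 5 + s
    2<5+s = s≤s (s≤s (s≤s z≤n))

    4+s<5+s : 4 + s < 5 + s
    4+s<5+s = n<1+n (4 + s)

    x~q⇔ : i < 5 + s → Adj G x (q i) ⇔ PanStep s (5 + s) i
    x~q⇔ {i} i< = mk⇔ to from
      where
      to : Adj G x (q i) → PanStep s (5 + s) i
      to x~qᵢ with x~q⇒ i< x~qᵢ
      ... | inj₁ e = inj₂ (inj₁ (refl , injective i< 2<5+s e))
      ... | inj₂ e = inj₁ (inj₂ (cong suc (≡-sym (injective i< 4+s<5+s e))))
      from : PanStep s (5 + s) i → Adj G x (q i)
      from (inj₁ (inj₁ refl))       = ⊥-elim (<-asym i< (n<1+n _))
      from (inj₁ (inj₂ refl))       = x~qₗ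
      from (inj₂ (inj₁ (_ , refl))) = x~q₂
      from (inj₂ (inj₂ (refl , _))) = ⊥-elim (<-irrefl refl i<)

    q~q⇔ : i < 5 + s → j < 5 + s → Adj G (q i) (q j) ⇔ PanStep s i j
    q~q⇔ i< j< = mk⇔ (inj₁ ∘ adjacent⇒consecutive i< j<) from
      where
      from : PanStep s _ _ → Adj G (q _) (q _)
      from (inj₁ c)               = consecutive⇒adjacent G P i< j< c
      from (inj₂ (inj₁ (refl , _))) = ⊥-elim (<-irrefl refl i<)
      from (inj₂ (inj₂ (refl , _))) = ⊥-elim (<-irrefl refl j<)

    x~x⇔ : Adj G x x ⇔ PanStep s (5 + s) (5 + s)
    x~x⇔ = mk⇔ (⊥-elim ∘ Graph.irrefl G) λ
      { (inj₁ c) → ⊥-elim (Consecutive-irrefl c)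
      ; (inj₂ (inj₁ (_ , ()))) ; (inj₂ (inj₂ (_ , ()))) }

    q′-q : i < 5 + s → q′ i ≡ q i
    q′-q = join-< (5 + s) q (const x)

    q′-x : q′ (5 + s) ≡ x
    q′-x = join-at (5 + s) q (const x)

    inj : i < 6 + s → j < 6 + s → q′ i ≡ q′ j → i ≡ j
    inj i< j< e with m<1+n⇒m<n∨m≡n i< | m<1+n⇒m<n∨m≡n j<
    ... | inj₁ i< | inj₁ j< = injective i< j< (trans (≡-sym (q′-q i<)) (trans e (q′-q j<)))
    ... | inj₁ i< | inj₂ refl = ⊥-elim (x∉q i< (trans (≡-sym q′-x) (trans (≡-sym e) (q′-q i<))))
    ... | inj₂ refl | inj₁ j< = ⊥-elim (x∉q j< (trans (≡-sym q′-x) (trans e (q′-q j<))))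
    ... | inj₂ refl | inj₂ refl = refl

    adj : i < 6 + s → j < 6 + s → Adj G (q′ i) (q′ j) ⇔ PanStep s i j
    adj i< j< with m<1+n⇒m<n∨m≡n i< | m<1+n⇒m<n∨m≡n j<
    ... | inj₁ i< | inj₁ j< rewrite q′-q i< | q′-q j< = q~q⇔ i< j<
    ... | inj₂ refl | inj₁ j< rewrite q′-x | q′-q j< = x~q⇔ j<
    ... | inj₁ i< | inj₂ refl rewrite q′-x | q′-q i< =
      mk⇔ (PanStep-sym ∘ Equivalence.to (x~q⇔ i<) ∘ Graph.sym G)
          (Graph.sym G ∘ Equivalence.from (x~q⇔ i<) ∘ PanStep-sym)
    ... | inj₂ refl | inj₂ refl rewrite q′-x = x~x⇔

  apexedPath⇒subdivision : ∀ {S : Fin n → Set} {q x} → InducedPath G q (5 + s) →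
    (∀ {i} → i < 5 + s → x ≢ q i) →
    (∀ {i} → i < 5 + s → Adj G x (q i) → q i ≡ q 2 ⊎ q i ≡ q (4 + s)) →
    Adj G x (q 2) → Adj G x (q (4 + s)) →
    (∀ i → S (q i)) → S x → HasInducedSubdivOf2Pan G S
  apexedPath⇒subdivision {s} {S} {q} {x} Q x∉q x~q⇒ x~q₂ x~qₗ q∈S x∈S =
    panModel⇒subdivision {S = S} {s = s} (apexedPath⇒PanModel Q x∉q x~q⇒ x~q₂ x~qₗ)
                         (join-all S (5 + s) q (const x) q∈S (const x∈S))

module _ {p} {P : Pred ℕ p} (P? : Decidable P) where

  private
    below-suc : ∀ {N a} → (a < N → ¬ P a) → ¬ P N → a < suc N → ¬ P a
    below-suc ¬P< ¬PN a<1+N = [ ¬P< , (λ { refl → ¬PN }) ] (m<1+n⇒m<n∨m≡n a<1+N)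

  lastSatisfying : ∀ N → (∀ a → a < N → ¬ P a) ⊎
                         ∃[ b ] (b < N × P b × ∀ a → b < a → a < N → ¬ P a)
  lastSatisfying zero = inj₁ λ _ ()
  lastSatisfying (suc N) with P? N | lastSatisfying N
  ... | yes PN | _ = inj₂ (N , n<1+n N , PN , λ a N<a a<1+N → ⊥-elim (<⇒≱ N<a (m<1+n⇒m≤n a<1+N)))
  ... | no ¬PN | inj₁ none = inj₁ λ a → below-suc (none a) ¬PN
  ... | no ¬PN | inj₂ (b , b<N , Pb , above) =
    inj₂ (b , <-trans b<N (n<1+n N) , Pb , λ a b<a → below-suc (above a b<a) ¬PN)

toℕ-mod : .{{_ : NonZero N}} → a < N → toℕ (a mod N) ≡ a
toℕ-mod a<N = trans (toℕ-fromℕ< _) (m<n⇒m%n≡m a<N)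

suc-% : a < suc N → suc a % suc N ≡ suc a ⊎ (a ≡ N × suc a % suc N ≡ 0)
suc-% {N = N} a< with m<1+n⇒m<n∨m≡n a<
... | inj₁ a<N = inj₁ (m<n⇒m%n≡m (s≤s a<N))
... | inj₂ refl = inj₂ (refl , n%n≡0 (suc N))

module _ {n : ℕ} {G : Graph n} where

  IsInducedPath⇒InducedPath : ∀ {p} .{{_ : NonZero N}} → IsInducedPath G N p →
                              InducedPath G (λ i → p (i mod N)) N
  IsInducedPath⇒InducedPath P = record
    { injective            = λ i<N j<N e →
                               trans (≡-sym (toℕ-mod i<N)) (trans (cong toℕ (injective e)) (toℕ-mod j<N))
    ; adjacent⇒consecutive = λ i<N j<N x →
                               subst₂ Consecutive (toℕ-mod i<N) (toℕ-mod j<N) (Equivalence.to (adjacency _ _) x)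
    ; adjacent-suc         = λ i<N → Equivalence.from (adjacency _ _)
                               (inj₁ (trans (toℕ-mod i<N) (cong suc (≡-sym (toℕ-mod (<-trans (n<1+n _) i<N))))))
    }
    where open IsInducedPath P

  module InducedCycle {M} {v : Fin (suc M) → Fin n} (C : IsInducedCycle G (suc M) v) where
    open IsInducedCycle C

    V : ℕ → Fin n
    V a = v (a mod suc M)

    V-injective : a < suc M → b < suc M → V a ≡ V b → a ≡ b
    V-injective a< b< e = trans (≡-sym (toℕ-mod a<)) (trans (cong toℕ (injective e)) (toℕ-mod b<))

    V-adjacent⇔ : a < suc M → b < suc M → Adj G (V a) (V b) ⇔ (b ≡ suc a % suc M ⊎ a ≡ suc b % suc M)
    V-adjacent⇔ {a} {b} a< b< =
      subst₂ (λ x y → Adj G (V a) (V b) ⇔ (y ≡ suc x % suc M ⊎ x ≡ suc y % suc M))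
             (toℕ-mod a<) (toℕ-mod b<) (adjacency (a mod suc M) (b mod suc M))

    deleteV₀ : InducedPath G (V ∘ suc) M
    deleteV₀ = record
      { injective            = λ i< j< → suc-injective ∘ V-injective (s≤s i<) (s≤s j<)
      ; adjacent⇒consecutive = λ i< j< x →
                                 +-Consecutive⁻ 1 (rotate i< j< (Equivalence.to (V-adjacent⇔ (s≤s i<) (s≤s j<)) x))
      ; adjacent-suc         = λ i< → Equivalence.from (V-adjacent⇔ (s≤s (<-trans (n<1+n _) i<)) (s≤s i<))
                                        (inj₁ (≡-sym (m<n⇒m%n≡m (s≤s i<))))
      }
      where
      rotate : i < M → j < M → suc j ≡ suc (suc i) % suc M ⊎ suc i ≡ suc (suc j) % suc M →
               Consecutive (suc i) (suc j)
      rotate i< j< (inj₁ e) with suc-% (s≤s i<)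
      ... | inj₁ e′       = inj₁ (trans e e′)
      ... | inj₂ (_ , e′) = ⊥-elim (0≢1+n (≡-sym (trans e e′)))
      rotate i< j< (inj₂ e) with suc-% (s≤s j<)
      ... | inj₁ e′       = inj₂ (trans e e′)
      ... | inj₂ (_ , e′) = ⊥-elim (0≢1+n (≡-sym (trans e e′)))

    V₀-neighbour : 0 < a → a < suc M → Adj G (V 0) (V a) → a ≡ 1 ⊎ a ≡ M
    V₀-neighbour {a} 0<a a< x with Equivalence.to (V-adjacent⇔ (s≤s z≤n) a<) x
    ... | inj₁ e = inj₁ (trans e (m<n⇒m%n≡m (≤-<-trans 0<a a<)))
    ... | inj₂ e with suc-% a<
    ...   | inj₁ e′        = ⊥-elim (0≢1+n (trans e e′))
    ...   | inj₂ (a≡M , _) = inj₂ a≡M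

    V₀~V₁ : 1 < suc M → Adj G (V 0) (V 1)
    V₀~V₁ 1< = Equivalence.from (V-adjacent⇔ (s≤s z≤n) 1<) (inj₁ (≡-sym (m<n⇒m%n≡m 1<)))

    V₀~Vₘ : Adj G (V 0) (V M)
    V₀~Vₘ = Equivalence.from (V-adjacent⇔ (s≤s z≤n) ≤-refl) (inj₂ (≡-sym (n%n≡0 (suc M))))

    V-adjacent⇒consecutive : 0 < a → a < suc M → 0 < b → b < suc M → Adj G (V a) (V b) → Consecutive a b
    V-adjacent⇒consecutive {a = suc a} {b = suc b} _ (s≤s a<) _ (s≤s b<) x =
      +-Consecutive 1 (InducedPath.adjacent⇒consecutive deleteV₀ a< b< x)

module Configuration {n : ℕ} (G : Graph n) (k : ℕ) (v : Fin (4 + k) → Fin n) (w : Fin 4 → Fin n)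
  (C : IsInducedCycle G (4 + k) v)
  (w∉C : ∀ (j : Fin 4) (i : Fin (4 + k)) → w j ≢ v i)
  (P : IsInducedPath G 5 (v (suc zero) ∷ w))
  (C₄~w : ∀ (i j : Fin 4) → Adj G (v (i ↑ˡ k)) (w j) → (i ≡ suc zero × j ≡ zero))
  (C~w-unique : ∀ (i : Fin (4 + k)) (j j′ : Fin 4) → Adj G (v i) (w j) → Adj G (v i) (w j′) → j ≡ j′)
  where

  open InducedCycle C
  open InducedPath

  m : ℕ
  m = 4 + k

  -- V a, W j and U are the paper's v_(a+1), w_(j+1) and the path v₂ w₁ w₂ w₃ w₄.
  U : ℕ → Fin n
  U j = (v (suc zero) ∷ w) (j mod 5)

  W : ℕ → Fin n
  W j = U (suc j)

  U-path : InducedPath G U 5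
  U-path = IsInducedPath⇒InducedPath P

  W-path : InducedPath G W 4
  W-path = drop⁺ G 1 U-path

  W-index : j < 4 → ∃[ t ] W j ≡ w t × toℕ t ≡ j
  W-index j< = fromℕ< j< ,
    cong (v (suc zero) ∷ w) (toℕ-injective (trans (toℕ-mod (s≤s j<)) (cong suc (≡-sym (toℕ-fromℕ< j<))))) ,
    toℕ-fromℕ< j<

  V-index : (a< : a < 4) → V a ≡ v (fromℕ< a< ↑ˡ k)
  V-index a< = cong v (toℕ-injective (trans (toℕ-mod (≤-trans a< (m≤m+n 4 k)))
                                             (≡-sym (trans (toℕ-↑ˡ _ k) (toℕ-fromℕ< a<)))))

  W≢V : j < 4 → W j ≢ V a
  W≢V {a = a} j< e with W-index j<
  ... | t , Wj≡wt , _ = w∉C t (a mod m) (trans (≡-sym Wj≡wt) e)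

  V<4~W : a < 4 → j < 4 → Adj G (V a) (W j) → a ≡ 1 × j ≡ 0
  V<4~W a< j< x with W-index j<
  ... | t , Wj≡wt , refl with C₄~w (fromℕ< a<) t (subst₂ (Adj G) (V-index a<) Wj≡wt x)
  ...   | i≡1 , refl = trans (≡-sym (toℕ-fromℕ< a<)) (cong toℕ i≡1) , refl

  V~W-unique : j < 4 → j′ < 4 → Adj G (V a) (W j) → Adj G (V a) (W j′) → j ≡ j′
  V~W-unique {a = a} j< j′< x x′ with W-index j< | W-index j′<
  ... | t , Wj≡wt , refl | t′ , Wj′≡wt′ , refl =
    cong toℕ (C~w-unique (a mod m) t t′ (subst (Adj G (V a)) Wj≡wt x) (subst (Adj G (V a)) Wj′≡wt′ x′))

  S : Fin n → Set
  S x = (∃[ i ] v i ≡ x) ⊎ (∃[ j ] w j ≡ x)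

  V∈S : ∀ a → S (V a)
  V∈S a = inj₁ (a mod m , refl)

  U∈S : ∀ j → S (U j)
  U∈S j with j mod 5
  ... | zero  = inj₁ (suc zero , refl)
  ... | suc t = inj₂ (t , refl)

  Goal : Set
  Goal = HasInducedSubdivOf2Pan G S

  data Vertex≥ (lo : ℕ) : Fin n → Set where
    onCycle : lo ≤ a → a < m → Vertex≥ lo (V a)
    onPath  : j < 4 → Vertex≥ lo (W j)

  Vertex≥-weaken : ∀ {lo lo′ y} → lo ≤ lo′ → Vertex≥ lo′ y → Vertex≥ lo y
  Vertex≥-weaken lo≤ (onCycle lo′≤a a<) = onCycle (≤-trans lo≤ lo′≤a) a<
  Vertex≥-weaken lo≤ (onPath j<)        = onPath j<

  OffV₀ : Fin n → Set
  OffV₀ = Vertex≥ 1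

  V₀∉OffV₀ : ∀ {y} → OffV₀ y → V 0 ≢ y
  V₀∉OffV₀ (onCycle 0<a a<) e = <-irrefl (V-injective {a = 0} (s≤s z≤n) a< e) 0<a
  V₀∉OffV₀ (onPath j<)      e = W≢V {a = 0} j< (≡-sym e)

  V₀-neighbour-OffV₀ : ∀ {y} → OffV₀ y → Adj G (V 0) y → y ≡ V 1 ⊎ y ≡ V (3 + k)
  V₀-neighbour-OffV₀ (onCycle 0<a a<) x = Data.Sum.map (cong V) (cong V) (V₀-neighbour 0<a a< x)
  V₀-neighbour-OffV₀ (onPath j<)      x with V<4~W (s≤s z≤n) j< x
  ... | () , _

  V₀-apexed : ∀ {s q} → InducedPath G q (5 + s) → (∀ {i} → i < 5 + s → OffV₀ (q i)) →
              q 2 ≡ V 1 → q (4 + s) ≡ V (3 + k) → (∀ i → S (q i)) → Goal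
  V₀-apexed {s} {q} Q off q₂≡ qₗ≡ q∈S =
    apexedPath⇒subdivision G {S = S} Q (λ i< → V₀∉OffV₀ (off i<)) neighbours
      (subst (Adj G (V 0)) (≡-sym q₂≡) (V₀~V₁ (s≤s (s≤s z≤n))))
      (subst (Adj G (V 0)) (≡-sym qₗ≡) V₀~Vₘ)
      q∈S (V∈S 0)
    where
    neighbours : i < 5 + s → Adj G (V 0) (q i) → q i ≡ q 2 ⊎ q i ≡ q (4 + s)
    neighbours i< x = Data.Sum.map (λ e → trans e (≡-sym q₂≡)) (λ e → trans e (≡-sym qₗ≡))
                                   (V₀-neighbour-OffV₀ (off i<) x)

  panOnC : (∀ a → 4 ≤ a → a < m → ∀ j → j ≤ 1 → ¬ Adj G (V a) (W j)) → Goal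
  panOnC w₁w₂-far =
    V₀-apexed Q off refl refl (join-all S 2 _ _ (λ i → U∈S (suc (1 ∸ i))) (λ j → V∈S (suc j)))
    where
    q = join 2 (W ∘ (1 ∸_)) (V ∘ suc)

    1∸i<4 : ∀ i → 1 ∸ i < 4
    1∸i<4 i = <-≤-trans (s≤s (m∸n≤m 1 i)) (s≤s (s≤s z≤n))

    disjoint : i < 2 → j < 3 + k → W (1 ∸ i) ≢ V (suc j)
    disjoint {i} {j} _ _ = W≢V {a = suc j} (1∸i<4 i)

    edges : i < 2 → j < 3 + k → Adj G (W (1 ∸ i)) (V (suc j)) → W (1 ∸ i) ≡ W 0 × V (suc j) ≡ V 1
    edges {i} {j} _ j< x with suc j <? 4
    ... | yes 1+j<4 with V<4~W 1+j<4 (1∸i<4 i) (Graph.sym G x)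
    ...   | 1+j≡1 , 1∸i≡0 = cong W 1∸i≡0 , cong V 1+j≡1
    edges {i} {j} _ j< x | no 1+j≮4 =
      ⊥-elim (w₁w₂-far (suc j) (≮⇒≥ 1+j≮4) (s≤s j<) (1 ∸ i) (m∸n≤m 1 i) (Graph.sym G x))

    Q : InducedPath G q (5 + k)
    Q = join⁺ G (reverse⁺ G (take⁺ G (s≤s (s≤s z≤n)) W-path)) deleteV₀ disjoint edges
               (Graph.sym G (adjacent-suc U-path (s≤s (s≤s z≤n))))

    off : i < 5 + k → OffV₀ (q i)
    off {i} i< = join-elim OffV₀ 2 _ _ i< (λ _ → onPath (1∸i<4 i))
                                          (λ j j< _ → onCycle (s≤s z≤n) (s≤s j<))

  V-segment : ∀ b e → b + suc e ≡ m → 0 < b → InducedPath G (V ∘ (b +_)) (suc e)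
  V-segment (suc b) e b+1+e≡m _ =
    drop⁺ G b (subst (InducedPath G (V ∘ suc)) (≡-sym (suc-injective b+1+e≡m)) deleteV₀)

  panThroughW : ∀ b e T → 5 ≤ b → b + suc e ≡ m → T < 4 → Adj G (V b) (W T) →
          (∀ a → b < a → a < m → ∀ j → j < 4 → ¬ Adj G (V a) (W j)) → Goal
  panThroughW b e T 5≤b b+1+e≡m T< Vb~WT beyond-far =
    V₀-apexed {s = T + e} (subst (InducedPath G q) length≡ Q) (λ {i} i< → off (subst (i <_) (≡-sym length≡) i<))
              refl qₗ≡
              (join-all S 3 _ _ (λ i → V∈S (suc (2 ∸ i))) (join-all S (suc T) _ _ (U∈S ∘ suc) (V∈S ∘ (b +_))))
    where
    inner = join (suc T) W (V ∘ (b +_))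
    q = join 3 (λ i → V (suc (2 ∸ i))) inner

    length≡ : 3 + (suc T + suc e) ≡ 5 + (T + e)
    length≡ = cong (4 +_) (+-suc T e)

    b+j<m : j < suc e → b + j < m
    b+j<m {j} j< = subst (b + j <_) b+1+e≡m (+-monoʳ-< b j<)

    inner-edges : i < suc T → j < suc e → Adj G (W i) (V (b + j)) → W i ≡ W T × V (b + j) ≡ V (b + 0)
    inner-edges {i} {zero}  i< _  x =
      cong W (V~W-unique {a = b} (≤-trans i< T<) T<
                (subst (λ c → Adj G (V c) (W i)) (+-identityʳ b) (Graph.sym G x)) Vb~WT) , refl
    inner-edges {i} {suc j} i< j< x =
      ⊥-elim (beyond-far (b + suc j) (m<m+n b (s≤s z≤n)) (b+j<m j<) i (≤-trans i< T<) (Graph.sym G x))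

    Inner : InducedPath G inner (suc T + suc e)
    Inner = join⁺ G (take⁺ G T< W-path) (V-segment b e b+1+e≡m (≤-trans (s≤s z≤n) 5≤b))
                  (λ {i} {j} i< _ → W≢V {a = b + j} (≤-trans i< T<)) inner-edges
                  (subst (λ c → Adj G (W T) (V c)) (≡-sym (+-identityʳ b)) (Graph.sym G Vb~WT))

    inner-vertex : j < suc T + suc e → Vertex≥ 5 (inner j)
    inner-vertex j< = join-elim (Vertex≥ 5) (suc T) _ _ j< (λ j< → onPath (≤-trans j< T<))
      (λ j j< _ → onCycle (≤-trans 5≤b (m≤m+n b j)) (b+j<m j<))

    2∸i+1<4 : ∀ i → suc (2 ∸ i) < 4
    2∸i+1<4 i = s≤s (s≤s (m∸n≤m 2 i))

    low≢inner : ∀ {y} → Vertex≥ 5 y → V (suc (2 ∸ i)) ≢ y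
    low≢inner {i} (onCycle 5≤c c<) e = <⇒≢ (≤-trans (2∸i+1<4 i) (≤-trans (n≤1+n 4) 5≤c))
                                            (V-injective (≤-trans (2∸i+1<4 i) (m≤m+n 4 k)) c< e)
    low≢inner {i} (onPath j<)      e = W≢V {a = suc (2 ∸ i)} j< (≡-sym e)

    low-edges : ∀ {y} → Vertex≥ 5 y → Adj G (V (suc (2 ∸ i))) y → V (suc (2 ∸ i)) ≡ V 1 × y ≡ W 0
    low-edges {i} (onCycle 5≤c c<) x = ⊥-elim (far-¬Consecutive (≤-trans (s≤s (2∸i+1<4 i)) 5≤c)
      (V-adjacent⇒consecutive (s≤s z≤n) (≤-trans (2∸i+1<4 i) (m≤m+n 4 k)) (≤-trans (s≤s z≤n) 5≤c) c< x))
    low-edges {i} (onPath j<)      x with V<4~W (2∸i+1<4 i) j< x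
    ... | 2∸i+1≡1 , j≡0 = cong V 2∸i+1≡1 , cong W j≡0

    Q : InducedPath G q (3 + (suc T + suc e))
    Q = join⁺ G (reverse⁺ G (take⁺ G (s≤s (s≤s (s≤s z≤n))) deleteV₀)) Inner
               (λ {i} _ j< → low≢inner {i} (inner-vertex j<)) (λ {i} _ j< → low-edges {i} (inner-vertex j<))
               (adjacent-suc U-path (s≤s (s≤s z≤n)))

    off : i < 3 + (suc T + suc e) → OffV₀ (q i)
    off {i} i< = join-elim OffV₀ 3 _ _ i< (λ _ → onCycle (s≤s z≤n) (≤-trans (2∸i+1<4 i) (m≤m+n 4 k)))
      (λ j j< _ → Vertex≥-weaken (s≤s z≤n) (inner-vertex j<))

    qₗ≡ : q (4 + (T + e)) ≡ V (3 + k)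
    qₗ≡ = trans (join-+ (suc T) W (V ∘ (b +_)) e)
                (cong V (suc-injective (trans (≡-sym (+-suc b e)) b+1+e≡m)))

  data UVertex : Fin n → Set where
    isV₁ : UVertex (V 1)
    isW  : j < 4 → UVertex (W j)

  U-vertex : j < 5 → UVertex (U j)
  U-vertex {zero}  _        = isV₁
  U-vertex {suc j} (s≤s j<) = isW j<

  panAtV₄ : ∀ T → T ≤ 1 → 4 < m → Adj G (V 4) (W T) → Goal
  panAtV₄ T T≤1 4<m V₄~WT =
    apexedPath⇒subdivision G {s = suc T} {S = S} (subst (InducedPath G q) length≡ Q)
      (λ {i} i< → apex∉q (subst (i <_) (≡-sym length≡) i<))
      (λ {i} i< → apex-neighbour (subst (i <_) (≡-sym length≡) i<))
      V₄~WT (subst (Adj G (V 4)) (≡-sym qₗ≡) V₄~V₃)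
      (join-all S (4 + T) _ _ (λ i → U∈S ((3 + T) ∸ i)) (λ j → V∈S (2 + j))) (V∈S 4)
    where
    q = join (4 + T) (λ i → U ((3 + T) ∸ i)) (V ∘ (2 +_))

    length≡ : (4 + T) + 2 ≡ 5 + suc T
    length≡ = cong (4 +_) (+-comm T 2)

    2+j<m : j < 2 → 2 + j < m
    2+j<m j< = ≤-trans (s≤s (s≤s j<)) (≤-trans (n≤1+n 4) 4<m)

    V₄~V₃ : Adj G (V 4) (V 3)
    V₄~V₃ = Graph.sym G (adjacent-suc deleteV₀ (≤-pred 4<m))

    qₗ≡ : q (4 + suc T) ≡ V 3
    qₗ≡ = trans (cong (q ∘ (4 +_)) (+-comm 1 T)) (join-+ (4 + T) (λ i → U ((3 + T) ∸ i)) (V ∘ (2 +_)) 1)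

    U≢V₂₊ : ∀ {y} → UVertex y → j < 2 → y ≢ V (2 + j)
    U≢V₂₊ isV₁    j< e = 0≢1+n (suc-injective (V-injective (s≤s (s≤s z≤n)) (2+j<m j<) e))
    U≢V₂₊ {j} (isW j′<) j< = W≢V {a = 2 + j} j′<

    U~V₂₊ : ∀ {y} → UVertex y → j < 2 → Adj G y (V (2 + j)) → y ≡ V 1 × j ≡ 0
    U~V₂₊ isV₁ j< x with V-adjacent⇒consecutive (s≤s z≤n) (s≤s (s≤s z≤n)) (s≤s z≤n) (2+j<m j<) x
    ... | inj₁ 2+j≡2 = refl , suc-injective (suc-injective 2+j≡2)
    ... | inj₂ ()
    U~V₂₊ (isW j′<) j< x with V<4~W (s≤s (s≤s j<)) j′< (Graph.sym G x)
    ... | () , _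

    3+T∸i<5 : ∀ i → (3 + T) ∸ i < 5
    3+T∸i<5 i = s≤s (≤-trans (m∸n≤m (3 + T) i) (s≤s (s≤s (s≤s T≤1))))

    U₀≡ : U ((3 + T) ∸ (3 + T)) ≡ V 1
    U₀≡ = cong U (n∸n≡0 (3 + T))

    Q : InducedPath G q ((4 + T) + 2)
    Q = join⁺ G (reverse⁺ G (take⁺ G (s≤s (s≤s (s≤s (s≤s T≤1)))) U-path))
                (take⁺ G (s≤s (s≤s z≤n)) (V-segment 2 (suc k) refl (s≤s z≤n)))
                (λ {i} i< → U≢V₂₊ (U-vertex (3+T∸i<5 i)))
                (λ {i} i< j< x → Data.Product.map (λ e → trans e (≡-sym U₀≡)) (cong (V ∘ (2 +_)))
                                   (U~V₂₊ (U-vertex (3+T∸i<5 i)) j< x))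
                (subst (λ y → Adj G y (V 2)) (≡-sym U₀≡)
                       (adjacent-suc deleteV₀ (≤-trans (s≤s (s≤s z≤n)) (≤-pred 4<m))))

    V₄∉U : ∀ {y} → UVertex y → V 4 ≢ y
    V₄∉U isV₁      e = 0≢1+n (≡-sym (suc-injective (V-injective 4<m (s≤s (s≤s z≤n)) e)))
    V₄∉U (isW j′<) e = W≢V {a = 4} j′< (≡-sym e)

    V₄~U : ∀ {y} → UVertex y → Adj G (V 4) y → y ≡ W T
    V₄~U isV₁ x with V-adjacent⇒consecutive (s≤s z≤n) 4<m (s≤s z≤n) (s≤s (s≤s z≤n)) x
    ... | inj₁ ()
    ... | inj₂ ()
    V₄~U (isW j′<) x = cong W (V~W-unique {a = 4} j′< (<-≤-trans (s≤s T≤1) (s≤s (s≤s z≤n))) x V₄~WT)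

    V₄~V₂₊ : j < 2 → Adj G (V 4) (V (2 + j)) → V (2 + j) ≡ V 3
    V₄~V₂₊ j< x with V-adjacent⇒consecutive (s≤s z≤n) 4<m (s≤s z≤n) (2+j<m j<) x
    V₄~V₂₊ (s≤s (s≤s ())) x | inj₁ refl
    ... | inj₂ refl = refl

    apex∉q : i < (4 + T) + 2 → V 4 ≢ q i
    apex∉q {i} i< = join-elim (V 4 ≢_) (4 + T) _ _ i< (λ _ → V₄∉U (U-vertex (3+T∸i<5 i)))
      (λ j j< _ e → <-irrefl (≡-sym (suc-injective (suc-injective (V-injective 4<m (2+j<m j<) e)))) j<)

    apex-neighbour : i < (4 + T) + 2 → Adj G (V 4) (q i) → q i ≡ q 2 ⊎ q i ≡ q (4 + suc T)
    apex-neighbour {i} i< = join-elim (λ y → Adj G (V 4) y → y ≡ W T ⊎ y ≡ q (4 + suc T)) (4 + T) _ _ i<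
      (λ _ x → inj₁ (V₄~U (U-vertex (3+T∸i<5 i)) x))
      (λ j j< _ x → inj₂ (trans (V₄~V₂₊ j< x) (≡-sym qₗ≡)))

  ≤1⇒<4 : j ≤ 1 → j < 4
  ≤1⇒<4 j≤1 = s≤s (≤-trans j≤1 (s≤s z≤n))

  FarWNeighbour : ℕ → Set
  FarWNeighbour a = 4 ≤ a × Σ[ t ∈ Fin 4 ] Adj G (V a) (W (toℕ t))

  farWNeighbour : j < 4 → 4 ≤ a → Adj G (V a) (W j) → FarWNeighbour a
  farWNeighbour {a = a} j< 4≤a x = 4≤a , fromℕ< j< , subst (Adj G (V a) ∘ W) (≡-sym (toℕ-fromℕ< j<)) x

  hasInducedSubdivOf2Pan : Goal
  hasInducedSubdivOf2Pan
    with lastSatisfying {P = FarWNeighbour} (λ a → (4 ≤? a) ×-dec any? λ t → adj? G (V a) (W (toℕ t))) m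
  ... | inj₁ none = panOnC λ a 4≤a a< j j≤1 x → none a a< (farWNeighbour (≤1⇒<4 j≤1) 4≤a x)
  ... | inj₂ (b , b< , (4≤b , t , Vb~Wt) , beyond) with b ≟ 4 | toℕ t ≤? 1
  ...   | no b≢4 | _ = panThroughW b (m ∸ suc b) (toℕ t) (≤∧≢⇒< 4≤b (b≢4 ∘ ≡-sym))
                         (trans (+-suc b _) (m+[n∸m]≡n b<)) (toℕ<n t) Vb~Wt
                         (λ a b<a a< j j< x → beyond a b<a a< (farWNeighbour j< (≤-trans 4≤b (<⇒≤ b<a)) x))
  ...   | yes refl | yes t≤1 = panAtV₄ (toℕ t) t≤1 b< Vb~Wt
  ...   | yes refl | no t≰1 = panOnC only-t
    where
    only-t : ∀ a → 4 ≤ a → a < m → ∀ j → j ≤ 1 → ¬ Adj G (V a) (W j)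
    only-t a 4≤a a< j j≤1 x with m≤n⇒m<n∨m≡n 4≤a
    ... | inj₁ 4<a  = beyond a 4<a a< (farWNeighbour (≤1⇒<4 j≤1) 4≤a x)
    ... | inj₂ refl = t≰1 (subst (_≤ 1) (V~W-unique {a = 4} (≤1⇒<4 j≤1) (toℕ<n t) x Vb~Wt) j≤1)

lemma8p8 : {n : ℕ} (G : Graph n) (k : ℕ) (v : Fin (4 + k) → Fin n) (w : Fin 4 → Fin n) →
    IsInducedCycle G (4 + k) v →
    (∀ (j : Fin 4) (i : Fin (4 + k)) → w j ≢ v i) →
    IsInducedPath G 5 (v (suc zero) ∷ w) →
    (∀ (i j : Fin 4) → Adj G (v (i ↑ˡ k)) (w j) → (i ≡ suc zero × j ≡ zero)) →
    (∀ (i : Fin (4 + k)) (j j′ : Fin 4) → Adj G (v i) (w j) → Adj G (v i) (w j′) → j ≡ j′) →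
    HasInducedSubdivOf2Pan G (λ x → (∃[ i ] v i ≡ x) ⊎ (∃[ j ] w j ≡ x))
lemma8p8 = Configuration.hasInducedSubdivOf2Pan
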